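{- Let $(G,b,x,2)$ be an instance of Collapsed $k$-Core with $k=2$ such that $G$ is its own $2$-core (i.e. $G$ has minimum degree at least $2$) and no connected component of $G$ is a cycle. If there is a solution $B$ for $(G,b,x,2)$, then there is also a solution $B'$ for $(G,b,x,2)$ that contains only vertices whose degree in $G$ is larger than $2$.
   Context: For an integer $k$, the $k$-core of an undirected graph $H$ is the (uniquely determined) largest induced subgraph of $H$ with minimum degree at least $k$; its size is its number of vertices. Collapsed $k$-Core: given an undirected graph $G=(V,E)$ and integers $b$, $x$, $k$, decide whether there is a set $S \subseteq V$ with $|S|\le b$ such that the $k$-core of $G-S$ has at most $x$ vertices. A solution for $(G,b,x,k)$ is a set $S \subseteq V$ with $|S|\le b$ such that the $k$-core of $G-S$ has at most $x$ vertices. -}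

module Defs where

open import Data.Nat using (ℕ; _≤_; _<_; _+_; _<?_; s≤s)
open import Data.Bool using (Bool; true; false; T)
open import Data.Fin using (Fin; zero; suc; toℕ; fromℕ<)
open import Data.Fin.Subset using (Subset; _∈_; _⊆_; _∩_; ∣_∣; ∁; Nonempty)
open import Data.Vec using (tabulate)
open import Data.Product using (Σ; ∃; _×_)
open import Relation.Binary.PropositionalEquality using (_≡_)
open import Relation.Nullary using (¬_; yes; no)
open import Data.Sum using (_⊎_)

record Graph : Set where
  field
    n     : ℕ
    adj   : Fin n → Fin n → Bool
    sym   : ∀ u v → adj u v ≡ adj v u
    irrefl : ∀ v → adj v v ≡ false

open Graph public

Adj : (G : Graph) → Fin (n G) → Fin (n G) → Set
Adj G u v = T (adj G u v)

N : (G : Graph) → Fin (n G) → Subset (n G)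
N G v = tabulate (adj G v)

deg : (G : Graph) → Fin (n G) → ℕ
deg G v = ∣ N G v ∣

degIn : (G : Graph) → Subset (n G) → Fin (n G) → ℕ
degIn G U v = ∣ N G v ∩ U ∣

MinDegIn : (G : Graph) → Subset (n G) → ℕ → Set
MinDegIn G C k = ∀ v → v ∈ C → k ≤ degIn G C v

IsKCore : (G : Graph) → Subset (n G) → ℕ → Subset (n G) → Set
IsKCore G U k C =
  C ⊆ U × MinDegIn G C k ×
  (∀ D → D ⊆ U → MinDegIn G D k → D ⊆ C)

Solution : (G : Graph) → ℕ → ℕ → ℕ → Subset (n G) → Set
Solution G b x k S =
  ∣ S ∣ ≤ b × ∃ λ C → IsKCore G (∁ S) k C × ∣ C ∣ ≤ x

data Reach (G : Graph) : Fin (n G) → Fin (n G) → Set where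
  here : ∀ {u} → Reach G u u
  step : ∀ {u v w} → Adj G u v → Reach G v w → Reach G u w

IsComponent : (G : Graph) → Subset (n G) → Set
IsComponent G C =
  Nonempty C ×
  (∀ u v → u ∈ C → v ∈ C → Reach G u v) ×
  (∀ u w → u ∈ C → Adj G u w → w ∈ C)

sucMod : ∀ {m} → Fin m → Fin m
sucMod {ℕ.suc m} i with toℕ i <? m
... | yes p = fromℕ< (s≤s p)
... | no _ = zero

IsCycle : (G : Graph) → Subset (n G) → Set
IsCycle G C =
  Σ ℕ λ m → 3 ≤ m × Σ (Fin m → Fin (n G)) λ f →
    (∀ i j → f i ≡ f j → i ≡ j) ×
    (∀ v → (v ∈ C → ∃ λ i → f i ≡ v) × (∀ i → f i ≡ v → v ∈ C)) ×
    (∀ i j → (Adj G (f i) (f j) → (j ≡ sucMod i ⊎ i ≡ sucMod j)) ×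
             ((j ≡ sucMod i ⊎ i ≡ sucMod j) → Adj G (f i) (f j)))

-- A subgraph of minimum degree 2 that contains a degree-2 vertex contains both of its
-- neighbours. So walk from a degree-2 vertex v along degree-2 vertices: the walk cannot
-- return to itself (an inner vertex would get a third neighbour, and returning to v would
-- close a component that is a cycle), hence it stops at a vertex u of degree > 2, and
-- every subgraph of minimum degree 2 containing v contains u. Replacing v by u in a
-- solution therefore cannot enlarge the 2-core of the rest; repeat until no vertex of
-- degree 2 is left in the solution.
module Submission where

open import Defs hiding (sym)
open import Data.Nat using (ℕ; zero; suc; _≤_; _<_; _∸_; _+_; z≤n; s≤s; _<?_; _≤?_)
open import Data.Nat.Properties
open import Data.Nat.Induction using (<-wellFounded)
open import Data.Bool using (Bool; T)
open import Data.Bool.Properties using (T-≡)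
open import Data.Fin as Fin using (Fin; toℕ; fromℕ<)
open import Data.Fin.Properties using (any?; pigeonhole; toℕ-injective; toℕ-fromℕ<; toℕ≤pred[n])
open import Data.Fin.Subset using (Subset; inside; outside; _∈_; _∉_; _⊆_; _⊂_; _∩_; _∪_; _─_; _-_; ⁅_⁆; ∣_∣; ∁)
open import Data.Fin.Subset.Properties
open import Data.Vec using (_∷_; []; there; tabulate)
open import Data.Vec.Properties using (lookup∘tabulate; []=⇒lookup; lookup⇒[]=)
open import Data.Product using (Σ; ∃; _×_; _,_; proj₁; proj₂)
open import Data.Sum using (_⊎_; inj₁; inj₂; map)
open import Function using (_∘_; _⇔_; mk⇔; Equivalence)
open import Induction.WellFounded using (Acc; acc)
open import Level using (Level)
open import Relation.Binary.PropositionalEquality using (_≡_; _≢_; refl; sym; trans; cong; subst)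
open import Relation.Nullary using (¬_; yes; no; contradiction)
open import Relation.Nullary.Decidable using (⌊_⌋; toWitness; fromWitness; decidable-stable; _×-dec_; ¬?)
open import Relation.Unary using (Pred; Decidable)

open Equivalence using (to; from)

private variable
  ℓ : Level
  m : ℕ
  p q : Subset m
  x y z : Fin m

∈-tabulate⇔ : ∀ {f : Fin m → Bool} → x ∈ tabulate f ⇔ T (f x)
∈-tabulate⇔ {x = x} {f = f} = mk⇔
  (λ x∈ → T-≡ .from (trans (sym (lookup∘tabulate f x)) ([]=⇒lookup x∈)))
  (λ fx → lookup⇒[]= x (tabulate f) (trans (lookup∘tabulate f x) (T-≡ .to fx)))

toSubset : {P : Pred (Fin m) ℓ} → Decidable P → Subset m
toSubset P? = tabulate (⌊_⌋ ∘ P?)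

∈-toSubset⇔ : {P : Pred (Fin m) ℓ} {P? : Decidable P} → x ∈ toSubset P? ⇔ P x
∈-toSubset⇔ {x = x} {P? = P?} =
  mk⇔ (toWitness {a? = P? x} ∘ ∈-tabulate⇔ .to) (∈-tabulate⇔ .from ∘ fromWitness {a? = P? x})

x∈p─q⇒x∉q : ∀ (p q : Subset m) → x ∈ p ─ q → x ∉ q
x∈p─q⇒x∉q (_ ∷ p) (_ ∷ q) (there x∈p─q) (there x∈q) = x∈p─q⇒x∉q p q x∈p─q x∈q

x∈p⇒0<∣p∣ : x ∈ p → 0 < ∣ p ∣
x∈p⇒0<∣p∣ {x = x} {p = p} x∈p = begin
  1           ≡⟨ ∣⁅x⁆∣≡1 x ⟨
  ∣ ⁅ x ⁆ ∣   ≤⟨ p⊆q⇒∣p∣≤∣q∣ (λ y∈⁅x⁆ → subst (_∈ p) (sym (x∈⁅y⁆⇒x≡y x y∈⁅x⁆)) x∈p) ⟩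
  ∣ p ∣       ∎
  where open ≤-Reasoning

∣p∪q∣≤∣p∣+∣q∣ : ∀ (p q : Subset m) → ∣ p ∪ q ∣ ≤ ∣ p ∣ + ∣ q ∣
∣p∪q∣≤∣p∣+∣q∣ []            []            = z≤n
∣p∪q∣≤∣p∣+∣q∣ (inside  ∷ p) (t       ∷ q) =
  s≤s (≤-trans (∣p∪q∣≤∣p∣+∣q∣ p q) (+-monoʳ-≤ ∣ p ∣ (∣p∣≤∣x∷p∣ t q)))
∣p∪q∣≤∣p∣+∣q∣ (outside ∷ p) (outside ∷ q) = ∣p∪q∣≤∣p∣+∣q∣ p q
∣p∪q∣≤∣p∣+∣q∣ (outside ∷ p) (inside  ∷ q) =
  ≤-trans (s≤s (∣p∪q∣≤∣p∣+∣q∣ p q)) (≤-reflexive (sym (+-suc ∣ p ∣ ∣ q ∣)))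

∣p∣≤∣p∩q∣⇒p⊆q : ∣ p ∣ ≤ ∣ p ∩ q ∣ → p ⊆ q
∣p∣≤∣p∩q∣⇒p⊆q {p = p} {q} ∣p∣≤∣p∩q∣ {x} x∈p with x ∈? q
... | yes x∈q = x∈q
... | no  x∉q = contradiction (p⊂q⇒∣p∣<∣q∣ p∩q⊂p) (≤⇒≯ ∣p∣≤∣p∩q∣)
  where
  p∩q⊂p : p ∩ q ⊂ p
  p∩q⊂p = p∩q⊆p p q , x , x∈p , x∉q ∘ proj₂ ∘ x∈p∩q⁻ p q

∣[p-x∪⁅y⁆]∩q∣<∣p∩q∣ : ∀ (p q : Subset m) → x ∈ p → x ∈ q → y ∉ q →
                      ∣ ((p - x) ∪ ⁅ y ⁆) ∩ q ∣ < ∣ p ∩ q ∣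
∣[p-x∪⁅y⁆]∩q∣<∣p∩q∣ {x = x} {y = y} p q x∈p x∈q y∉q =
  p⊂q⇒∣p∣<∣q∣ (shrunk , x , x∈p∩q⁺ (x∈p , x∈q) , x∉shrunk)
  where
  y∉q′ : ∀ {z} → z ∈ ⁅ y ⁆ → z ∉ q
  y∉q′ z∈⁅y⁆ z∈q = y∉q (subst (_∈ q) (x∈⁅y⁆⇒x≡y y z∈⁅y⁆) z∈q)
  shrunk : ((p - x) ∪ ⁅ y ⁆) ∩ q ⊆ p ∩ q
  shrunk z∈ with x∈p∩q⁻ _ q z∈
  ... | z∈∪ , z∈q with x∈p∪q⁻ (p - x) ⁅ y ⁆ z∈∪
  ... | inj₁ z∈p-x = x∈p∩q⁺ (p─q⊆p p ⁅ x ⁆ z∈p-x , z∈q)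
  ... | inj₂ z∈⁅y⁆ = contradiction z∈q (y∉q′ z∈⁅y⁆)
  x∉shrunk : x ∉ ((p - x) ∪ ⁅ y ⁆) ∩ q
  x∉shrunk x∈ with x∈p∪q⁻ (p - x) ⁅ y ⁆ (proj₁ (x∈p∩q⁻ _ q x∈))
  ... | inj₁ x∈p-x = x∈p─q⇒x∉q p ⁅ x ⁆ x∈p-x (x∈⁅x⁆ x)
  ... | inj₂ x∈⁅y⁆ = y∉q′ x∈⁅y⁆ x∈q

1<∣p∣⇒∃≢ : 1 < ∣ p ∣ → ∀ x → ∃ λ y → y ∈ p × y ≢ x
1<∣p∣⇒∃≢ {p = p} 1<∣p∣ x with any? (λ y → y ∈? p ×-dec ¬? (y Fin.≟ x))
... | yes found = found
... | no  none  = contradiction 1<∣p∣ (≤⇒≯ ∣p∣≤1)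
  where
  p⊆⁅x⁆ : p ⊆ ⁅ x ⁆
  p⊆⁅x⁆ {y} y∈p = subst (_∈ ⁅ x ⁆) (sym y≡x) (x∈⁅x⁆ x)
    where
    y≡x : y ≡ x
    y≡x = decidable-stable (y Fin.≟ x) (λ y≢x → none (y , y∈p , y≢x))
  ∣p∣≤1 : ∣ p ∣ ≤ 1
  ∣p∣≤1 = ≤-trans (p⊆q⇒∣p∣≤∣q∣ p⊆⁅x⁆) (≤-reflexive (∣⁅x⁆∣≡1 x))

distinct³⇒3≤∣p∣ : x ∈ p → y ∈ p → z ∈ p → x ≢ y → x ≢ z → y ≢ z → 3 ≤ ∣ p ∣
distinct³⇒3≤∣p∣ {x = x} {p = p} {y = y} x∈p y∈p z∈p x≢y x≢z y≢z = begin
  3                   ≤⟨ s≤s (s≤s (x∈p⇒0<∣p∣ z∈p-x-y)) ⟩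
  2 + ∣ p - x - y ∣   ≤⟨ s≤s (x∈p⇒∣p-x∣<∣p∣ y∈p-x) ⟩
  1 + ∣ p - x ∣       ≤⟨ x∈p⇒∣p-x∣<∣p∣ x∈p ⟩
  ∣ p ∣               ∎
  where
  open ≤-Reasoning
  y∈p-x = x∈p∧x≢y⇒x∈p-y y∈p (x≢y ∘ sym)
  z∈p-x-y = x∈p∧x≢y⇒x∈p-y (x∈p∧x≢y⇒x∈p-y z∈p (x≢z ∘ sym)) (y≢z ∘ sym)

next : ℕ → ℕ → ℕ
next k t with t <? k
... | yes _ = suc t
... | no  _ = 0

prev : ℕ → ℕ → ℕ
prev k zero    = k
prev k (suc t) = t

toℕ-sucMod : ∀ {k} (i : Fin (suc k)) → toℕ (sucMod i) ≡ next k (toℕ i)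
toℕ-sucMod {k} i with toℕ i <? k
... | yes i<k = toℕ-fromℕ< (s≤s i<k)
... | no  _   = refl

≡sucMod⇔ : ∀ {k} {i j : Fin (suc k)} → j ≡ sucMod i ⇔ toℕ j ≡ next k (toℕ i)
≡sucMod⇔ {i = i} = mk⇔ (λ j≡ → trans (cong toℕ j≡) (toℕ-sucMod i))
                       (λ j≡ → toℕ-injective (trans j≡ (sym (toℕ-sucMod i))))

next-< : ∀ {k t} → t < k → next k t ≡ suc t
next-< {k} {t} t<k with t <? k
... | yes _   = refl
... | no  t≮k = contradiction t<k t≮k

next-self : ∀ k → next k k ≡ 0
next-self k with k <? k
... | yes k<k = contradiction k<k (<-irrefl refl)
... | no  _   = refl

next-≤ : ∀ {k t} → t ≤ k → next k t ≤ k
next-≤ {k} t≤k with m≤n⇒m<n∨m≡n t≤k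
... | inj₁ t<k  = subst (_≤ _) (sym (next-< t<k)) t<k
... | inj₂ refl = subst (_≤ k) (sym (next-self k)) z≤n

prev-≤ : ∀ {k t} → t ≤ k → prev k t ≤ k
prev-≤ {t = zero}  _   = ≤-refl
prev-≤ {t = suc t} t<k = <⇒≤ t<k

next-prev : ∀ {k t} → t ≤ k → next k (prev k t) ≡ t
next-prev {t = zero}  _   = next-self _
next-prev {t = suc t} t<k = next-< t<k

next≢prev : ∀ {k t} → 2 ≤ k → t ≤ k → next k t ≢ prev k t
next≢prev {t = zero} 2≤k _ next≡k = <⇒≢ 2≤k (trans (sym (next-< (<⇒≤ 2≤k))) next≡k)
next≢prev {t = suc t} 2≤k t<k next≡t with m≤n⇒m<n∨m≡n t<k
... | inj₁ t+1<k =
  <⇒≢ (<-trans (n<1+n t) (n<1+n (suc t))) (sym (trans (sym (next-< t+1<k)) next≡t))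
... | inj₂ refl  = <⇒≢ (≤-pred 2≤k) (trans (sym (next-self _)) next≡t)

module _ (G : Graph) where

  private
    V : Set
    V = Fin (n G)

  Adj⇔∈N : ∀ {u w} → Adj G u w ⇔ w ∈ N G u
  Adj⇔∈N = mk⇔ (∈-tabulate⇔ .from) (∈-tabulate⇔ .to)

  Adj-sym : ∀ {u w} → Adj G u w → Adj G w u
  Adj-sym {u} {w} = subst T (Graph.sym G u w)

  Adj-irrefl : ∀ {u} → ¬ Adj G u u
  Adj-irrefl {u} = subst T (irrefl G u)

  deg≡2⇒neighbour≡ : ∀ {u w w′ w″} → deg G u ≡ 2 → Adj G u w → Adj G u w′ → w ≢ w′ →
                     Adj G u w″ → w″ ≡ w ⊎ w″ ≡ w′
  deg≡2⇒neighbour≡ {u} {w} {w′} {w″} deg≡2 u~w u~w′ w≢w′ u~w″ with w″ Fin.≟ w | w″ Fin.≟ w′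
  ... | yes w″≡w | _          = inj₁ w″≡w
  ... | no  _    | yes w″≡w′  = inj₂ w″≡w′
  ... | no  w″≢w | no  w″≢w′ =
    contradiction (subst (3 ≤_) deg≡2 three≤deg) (λ { (s≤s (s≤s ())) })
    where
    three≤deg : 3 ≤ deg G u
    three≤deg = distinct³⇒3≤∣p∣ (Adj⇔∈N .to u~w) (Adj⇔∈N .to u~w′) (Adj⇔∈N .to u~w″)
                                 w≢w′ (w″≢w ∘ sym) (w″≢w′ ∘ sym)

  other-neighbour : ∀ {u} → 2 ≤ deg G u → ∀ w → ∃ λ w′ → Adj G u w′ × w′ ≢ w
  other-neighbour 2≤deg w with 1<∣p∣⇒∃≢ 2≤deg w
  ... | w′ , w′∈N , w′≢w = w′ , Adj⇔∈N .from w′∈N , w′≢w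

  Reach-trans : ∀ {u v w} → Reach G u v → Reach G v w → Reach G u w
  Reach-trans here         v⇝w = v⇝w
  Reach-trans (step e u⇝v) v⇝w = step e (Reach-trans u⇝v v⇝w)

  degIn-mono : ∀ {D U} w → D ⊆ U → degIn G D w ≤ degIn G U w
  degIn-mono {D} {U} w D⊆U = p⊆q⇒∣p∣≤∣q∣ λ y∈ →
    let (y∈N , y∈D) = x∈p∩q⁻ (N G w) D y∈ in x∈p∩q⁺ (y∈N , D⊆U y∈D)

  IsKCore-self : ∀ {U k} → MinDegIn G U k → IsKCore G U k U
  IsKCore-self U-deg = (λ w∈U → w∈U) , U-deg , λ _ D⊆U _ → D⊆U

  IsKCore-remove : ∀ {U k C w} → w ∈ U → degIn G U w < k → IsKCore G (U - w) k C → IsKCore G U k C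
  IsKCore-remove {U} {k} {C} {w} w∈U low (C⊆U-w , C-deg , C-max) =
    p─q⊆p U ⁅ w ⁆ ∘ C⊆U-w , C-deg , λ D D⊆U D-deg → C-max D (D⊆U-w D⊆U D-deg) D-deg
    where
    D⊆U-w : ∀ {D} → D ⊆ U → MinDegIn G D k → D ⊆ U - w
    D⊆U-w {D} D⊆U D-deg {y} y∈D = x∈p∧x≢y⇒x∈p-y (D⊆U y∈D) λ { refl →
      <⇒≱ low (≤-trans (D-deg y y∈D) (degIn-mono y D⊆U)) }

  kCore-exists : ∀ k U → ∃ (IsKCore G U k)
  kCore-exists k U = peel U (<-wellFounded ∣ U ∣)
    where
    peel : ∀ U → Acc _<_ ∣ U ∣ → ∃ (IsKCore G U k)
    peel U (acc smaller) with any? (λ w → w ∈? U ×-dec degIn G U w <? k)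
    ... | yes (w , w∈U , low) =
      let (C , C-core) = peel (U - w) (smaller (x∈p⇒∣p-x∣<∣p∣ w∈U))
      in C , IsKCore-remove w∈U low C-core
    ... | no none = U , IsKCore-self λ w w∈U → ≮⇒≥ λ low → none (w , w∈U , low)

  Solution-transfer : ∀ {b x k S S′} → Solution G b x k S → ∣ S′ ∣ ≤ ∣ S ∣ →
                      (∀ D → D ⊆ ∁ S′ → MinDegIn G D k → D ⊆ ∁ S) → Solution G b x k S′
  Solution-transfer {k = k} {S′ = S′} (∣S∣≤b , C , (_ , _ , C-max) , ∣C∣≤x) ∣S′∣≤∣S∣ avoids
    with kCore-exists k (∁ S′)
  ... | C′ , C′-core@(C′⊆∁S′ , C′-deg , _) =
    ≤-trans ∣S′∣≤∣S∣ ∣S∣≤b , C′ , C′-core ,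
    ≤-trans (p⊆q⇒∣p∣≤∣q∣ (C-max C′ (avoids C′ C′⊆∁S′ C′-deg) C′-deg)) ∣C∣≤x

  Forces : ℕ → V → V → Set
  Forces k v u = ∀ D → MinDegIn G D k → v ∈ D → u ∈ D

  Forces-refl : ∀ {k v} → Forces k v v
  Forces-refl _ _ v∈D = v∈D

  Forces-trans : ∀ {k u v w} → Forces k u v → Forces k v w → Forces k u w
  Forces-trans u⇒v v⇒w D D-deg u∈D = v⇒w D D-deg (u⇒v D D-deg u∈D)

  deg≤⇒Forces-neighbour : ∀ {k v w} → deg G v ≤ k → Adj G v w → Forces k v w
  deg≤⇒Forces-neighbour {v = v} deg≤k v~w D D-deg v∈D =
    ∣p∣≤∣p∩q∣⇒p⊆q (≤-trans deg≤k (D-deg v v∈D)) (Adj⇔∈N .to v~w)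

  Solution-exchange : ∀ {b x k S v u} → Forces k v u → v ∈ S → Solution G b x k S →
                      Solution G b x k ((S - v) ∪ ⁅ u ⁆)
  Solution-exchange {k = k} {S} {v} {u} v⇒u v∈S sol = Solution-transfer sol ∣S′∣≤∣S∣ avoids
    where
    S′ = (S - v) ∪ ⁅ u ⁆
    u∈S′ : u ∈ S′
    u∈S′ = x∈p∪q⁺ (inj₂ (x∈⁅x⁆ u))
    ∣S′∣≤∣S∣ : ∣ S′ ∣ ≤ ∣ S ∣
    ∣S′∣≤∣S∣ = begin
      ∣ S′ ∣                 ≤⟨ ∣p∪q∣≤∣p∣+∣q∣ (S - v) ⁅ u ⁆ ⟩
      ∣ S - v ∣ + ∣ ⁅ u ⁆ ∣  ≡⟨ cong (∣ S - v ∣ +_) (∣⁅x⁆∣≡1 u) ⟩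
      ∣ S - v ∣ + 1          ≡⟨ +-comm ∣ S - v ∣ 1 ⟩
      suc ∣ S - v ∣          ≤⟨ x∈p⇒∣p-x∣<∣p∣ v∈S ⟩
      ∣ S ∣                  ∎
      where open ≤-Reasoning
    avoids : ∀ D → D ⊆ ∁ S′ → MinDegIn G D k → D ⊆ ∁ S
    avoids D D⊆∁S′ D-deg {y} y∈D = x∉p⇒x∈∁p (x∈∁p⇒x∉p (D⊆∁S′ y∈D) ∘ y∈S′)
      where
      y∈S′ : y ∈ S → y ∈ S′
      y∈S′ y∈S with y Fin.≟ v
      ... | yes refl = contradiction u∈S′ (x∈∁p⇒x∉p (D⊆∁S′ (v⇒u D D-deg y∈D)))
      ... | no  y≢v  = x∈p∪q⁺ (inj₁ (x∈p∧x≢y⇒x∈p-y y∈S y≢v))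

  ∃-Solution-disjoint : ∀ {b x k} T → (∀ {v} → v ∈ T → ∃ λ u → u ∉ T × Forces k v u) →
                        ∀ {S} → Solution G b x k S →
                        ∃ λ S′ → Solution G b x k S′ × (∀ {v} → v ∈ S′ → v ∉ T)
  ∃-Solution-disjoint {b} {x} {k} T escape {S} = go (<-wellFounded ∣ S ∩ T ∣)
    where
    go : ∀ {S} → Acc _<_ ∣ S ∩ T ∣ → Solution G b x k S →
         ∃ λ S′ → Solution G b x k S′ × (∀ {v} → v ∈ S′ → v ∉ T)
    go {S} (acc smaller) sol with nonempty? (S ∩ T)
    ... | no  S∩T-empty = S , sol , λ v∈S v∈T → S∩T-empty (_ , x∈p∩q⁺ (v∈S , v∈T))
    ... | yes (v , v∈S∩T) =
      let (v∈S , v∈T)     = x∈p∩q⁻ S T v∈S∩T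
          (u , u∉T , v⇒u) = escape v∈T
      in go (smaller (∣[p-x∪⁅y⁆]∩q∣<∣p∩q∣ S T v∈S v∈T u∉T)) (Solution-exchange v⇒u v∈S sol)

  -- Paths are grown at vertex 0; vertex k is where the path started.
  record Deg2Path (k : ℕ) : Set where
    field
      vertex   : ℕ → V
      linked   : ∀ {i} → i < k → Adj G (vertex (suc i)) (vertex i)
      deg≡2    : ∀ {i} → i < k → deg G (vertex (suc i)) ≡ 2
      distinct : ∀ {i j} → i ≤ k → j ≤ k → vertex i ≡ vertex j → i ≡ j

  open Deg2Path

  Deg2Path-length : ∀ {k} → Deg2Path k → k < n G
  Deg2Path-length {k} P = ≰⇒> λ n≤k →
    let (i , j , i<j , vi≡vj) = pigeonhole (s≤s n≤k) (vertex P ∘ toℕ)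
    in <⇒≢ i<j (distinct P (toℕ≤pred[n] i) (toℕ≤pred[n] j) vi≡vj)

  trivial-Deg2Path : V → Deg2Path 0
  trivial-Deg2Path v = record
    { vertex   = λ _ → v
    ; linked   = λ ()
    ; deg≡2    = λ ()
    ; distinct = λ { z≤n z≤n _ → refl }
    }

  extend : ∀ {k y} (P : Deg2Path k) → deg G (vertex P 0) ≡ 2 → Adj G (vertex P 0) y →
           (∀ {t} → t ≤ k → vertex P t ≢ y) → Deg2Path (suc k)
  extend {k} {y} P end-deg end~y fresh = record
    { vertex = vertex′ ; linked = linked′ ; deg≡2 = deg≡2′ ; distinct = distinct′ }
    where
    vertex′ : ℕ → V
    vertex′ zero    = y
    vertex′ (suc i) = vertex P i
    linked′ : ∀ {i} → i < suc k → Adj G (vertex′ (suc i)) (vertex′ i)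
    linked′ {zero}  _           = end~y
    linked′ {suc i} (s≤s i<k)   = linked P i<k
    deg≡2′ : ∀ {i} → i < suc k → deg G (vertex′ (suc i)) ≡ 2
    deg≡2′ {zero}  _            = end-deg
    deg≡2′ {suc i} (s≤s i<k)    = deg≡2 P i<k
    distinct′ : ∀ {i j} → i ≤ suc k → j ≤ suc k → vertex′ i ≡ vertex′ j → i ≡ j
    distinct′ {zero}  {zero}  _         _         _     = refl
    distinct′ {zero}  {suc j} _         (s≤s j≤k) y≡vj  = contradiction (sym y≡vj) (fresh j≤k)
    distinct′ {suc i} {zero}  (s≤s i≤k) _         vi≡y  = contradiction vi≡y (fresh i≤k)
    distinct′ {suc i} {suc j} (s≤s i≤k) (s≤s j≤k) vi≡vj = cong suc (distinct P i≤k j≤k vi≡vj)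

  module ClosedDeg2Path {k} (P : Deg2Path k) (2≤k : 2 ≤ k) (end-deg : deg G (vertex P 0) ≡ 2)
                        (closing : Adj G (vertex P 0) (vertex P k)) where

    v : ℕ → V
    v = vertex P

    all-deg≡2 : ∀ {t} → t ≤ k → deg G (v t) ≡ 2
    all-deg≡2 {zero}  _   = end-deg
    all-deg≡2 {suc t} t<k = deg≡2 P t<k

    edge-next : ∀ {t} → t ≤ k → Adj G (v t) (v (next k t))
    edge-next t≤k with m≤n⇒m<n∨m≡n t≤k
    ... | inj₁ t<k  = subst (Adj G (v _) ∘ v) (sym (next-< t<k)) (Adj-sym (linked P t<k))
    ... | inj₂ refl = subst (Adj G (v k) ∘ v) (sym (next-self k)) (Adj-sym closing)

    edge-prev : ∀ {t} → t ≤ k → Adj G (v t) (v (prev k t))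
    edge-prev {t} t≤k =
      Adj-sym (subst (Adj G (v (prev k t)) ∘ v) (next-prev t≤k) (edge-next (prev-≤ t≤k)))

    neighbour-cases : ∀ {t w} → t ≤ k → Adj G (v t) w → w ≡ v (next k t) ⊎ w ≡ v (prev k t)
    neighbour-cases t≤k = deg≡2⇒neighbour≡ (all-deg≡2 t≤k) (edge-next t≤k) (edge-prev t≤k)
      (next≢prev 2≤k t≤k ∘ distinct P (next-≤ t≤k) (prev-≤ t≤k))

    Adj⇔cyclic : ∀ {s t} → s ≤ k → t ≤ k → Adj G (v s) (v t) ⇔ (t ≡ next k s ⊎ s ≡ next k t)
    Adj⇔cyclic {s} {t} s≤k t≤k = mk⇔ to′ from′
      where
      to′ : Adj G (v s) (v t) → t ≡ next k s ⊎ s ≡ next k t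
      to′ s~t with neighbour-cases s≤k s~t
      ... | inj₁ vt≡next = inj₁ (distinct P t≤k (next-≤ s≤k) vt≡next)
      ... | inj₂ vt≡prev = inj₂ (trans (sym (next-prev s≤k))
                                       (cong (next k) (sym (distinct P t≤k (prev-≤ s≤k) vt≡prev))))
      from′ : t ≡ next k s ⊎ s ≡ next k t → Adj G (v s) (v t)
      from′ (inj₁ refl) = edge-next s≤k
      from′ (inj₂ refl) = Adj-sym (edge-next t≤k)

    to-end : ∀ {t} → t ≤ k → Reach G (v t) (v 0)
    to-end {zero}  _   = here
    to-end {suc t} t<k = step (linked P t<k) (to-end (<⇒≤ t<k))

    from-end : ∀ {t} → t ≤ k → Reach G (v 0) (v t)
    from-end {zero}  _   = here
    from-end {suc t} t<k = Reach-trans (from-end (<⇒≤ t<k)) (step (Adj-sym (linked P t<k)) here)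

    f : Fin (suc k) → V
    f = v ∘ toℕ

    C : Subset (n G)
    C = toSubset (λ w → any? (λ i → f i Fin.≟ w))

    ∈C⇔ : ∀ {w} → w ∈ C ⇔ ∃ λ i → f i ≡ w
    ∈C⇔ = ∈-toSubset⇔

    v∈C : ∀ {t} → t ≤ k → v t ∈ C
    v∈C t≤k = ∈C⇔ .from (fromℕ< (s≤s t≤k) , cong v (toℕ-fromℕ< (s≤s t≤k)))

    isComponent : IsComponent G C
    isComponent = (v 0 , v∈C z≤n) , connected , closed
      where
      connected : ∀ u w → u ∈ C → w ∈ C → Reach G u w
      connected u w u∈C w∈C with ∈C⇔ .to u∈C | ∈C⇔ .to w∈C
      ... | i , refl | j , refl = Reach-trans (to-end (toℕ≤pred[n] i)) (from-end (toℕ≤pred[n] j))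
      closed : ∀ u w → u ∈ C → Adj G u w → w ∈ C
      closed u w u∈C u~w with ∈C⇔ .to u∈C
      ... | i , refl with neighbour-cases (toℕ≤pred[n] i) u~w
      ... | inj₁ refl = v∈C (next-≤ (toℕ≤pred[n] i))
      ... | inj₂ refl = v∈C (prev-≤ (toℕ≤pred[n] i))

    isCycle : IsCycle G C
    isCycle = suc k , s≤s 2≤k , f ,
      (λ i j → toℕ-injective ∘ distinct P (toℕ≤pred[n] i) (toℕ≤pred[n] j)) ,
      (λ w → (∈C⇔ .to) , λ i fi≡w → ∈C⇔ .from (i , fi≡w)) ,
      λ i j → let adj⇔ = Adj⇔cyclic (toℕ≤pred[n] i) (toℕ≤pred[n] j) in
        (map (≡sucMod⇔ .from) (≡sucMod⇔ .from) ∘ adj⇔ .to) ,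
        (adj⇔ .from ∘ map (≡sucMod⇔ .to) (≡sucMod⇔ .to))

  module _ (min-deg : ∀ u → 2 ≤ deg G u) (no-cycle : ∀ C → IsComponent G C → ¬ IsCycle G C) where

    no-revisit : ∀ {k y} (P : Deg2Path k) → deg G (vertex P 0) ≡ 2 → Adj G (vertex P 0) y →
                 y ≢ vertex P 1 → ∀ {t} → t ≤ k → vertex P t ≢ y
    -- Returning to the start closes a cycle component; returning to an inner vertex
    -- would give it a third neighbour.
    no-revisit P end-deg end~y y≢v₁ {zero} _ v₀≡y = Adj-irrefl (subst (Adj G _) (sym v₀≡y) end~y)
    no-revisit P end-deg end~y y≢v₁ {suc zero} _ v₁≡y = y≢v₁ (sym v₁≡y)
    no-revisit P end-deg end~y y≢v₁ {suc (suc t)} t+2≤k vt≡y with m≤n⇒m<n∨m≡n t+2≤k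
    ... | inj₂ refl = no-cycle C isComponent isCycle
      where open ClosedDeg2Path P (s≤s (s≤s z≤n)) end-deg (subst (Adj G _) (sym vt≡y) end~y)
    ... | inj₁ t+2<k with deg≡2⇒neighbour≡ (deg≡2 P t+2≤k) (linked P t+2≤k) (Adj-sym (linked P t+2<k))
                            (λ e → contradiction (distinct P (<⇒≤ t+2≤k) t+2<k e) λ ())
                            (Adj-sym (subst (Adj G _) (sym vt≡y) end~y))
    ... | inj₁ v₀≡v₁₊ₜ = contradiction (distinct P z≤n (<⇒≤ t+2≤k) v₀≡v₁₊ₜ) λ ()
    ... | inj₂ v₀≡v₃₊ₜ = contradiction (distinct P z≤n t+2<k v₀≡v₃₊ₜ) λ ()

    grow : ∀ {k} (P : Deg2Path k) → deg G (vertex P 0) ≡ 2 →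
           Σ (Deg2Path (suc k)) λ P′ → Forces 2 (vertex P 0) (vertex P′ 0)
    -- For k = 0, vertex P 1 is not on the path, so avoiding it costs nothing.
    grow {k} P end-deg with other-neighbour (min-deg (vertex P 0)) (vertex P 1)
    ... | y , end~y , y≢v₁ with anyUpTo? (λ t → vertex P t Fin.≟ y) (suc k)
    ... | yes (t , t<1+k , vt≡y) = contradiction vt≡y (no-revisit P end-deg end~y y≢v₁ (≤-pred t<1+k))
    ... | no  fresh =
      extend P end-deg end~y (λ t≤k vt≡y → fresh (_ , s≤s t≤k , vt≡y)) ,
      deg≤⇒Forces-neighbour (≤-reflexive end-deg) end~y

    reach-high-degree : ∀ {k v} → Acc _<_ (n G ∸ k) → (P : Deg2Path k) → Forces 2 v (vertex P 0) →
                        ∃ λ u → 2 < deg G u × Forces 2 v u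
    reach-high-degree (acc shorter) P v⇒end with 2 <? deg G (vertex P 0)
    ... | yes high = vertex P 0 , high , v⇒end
    ... | no  ¬high with grow P (≤-antisym (≮⇒≥ ¬high) (min-deg _))
    ... | P′ , end⇒end′ =
      reach-high-degree (shorter (∸-monoʳ-< (n<1+n _) (Deg2Path-length P))) P′
                        (Forces-trans v⇒end end⇒end′)

    ∃-Forces-high-degree : ∀ v → ∃ λ u → 2 < deg G u × Forces 2 v u
    ∃-Forces-high-degree v = reach-high-degree (<-wellFounded _) (trivial-Deg2Path v) Forces-refl

lemma10 : (G : Graph) (b x : ℕ) →
    (∀ v → 2 ≤ deg G v) →
    (∀ C → IsComponent G C → ¬ IsCycle G C) →
    (B : Subset (n G)) → Solution G b x 2 B →
    ∃ λ B′ → Solution G b x 2 B′ × (∀ v → v ∈ B′ → 2 < deg G v)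
lemma10 G b x min-deg no-cycle B sol =
  let (B′ , sol′ , B′-avoids-low) = ∃-Solution-disjoint G low escape sol
  in B′ , sol′ , λ v v∈B′ → ≰⇒> (B′-avoids-low v∈B′ ∘ ∈-toSubset⇔ .from)
  where
  low : Subset (n G)
  low = toSubset (λ v → deg G v ≤? 2)
  escape : ∀ {v} → v ∈ low → ∃ λ u → u ∉ low × Forces G 2 v u
  escape {v} _ =
    let (u , high , v⇒u) = ∃-Forces-high-degree G min-deg no-cycle v
    in u , <⇒≱ high ∘ ∈-toSubset⇔ .to , v⇒u
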